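{- Let $G$ be a graph, let $C=a_1a_2a_3a_1$ be a triangle in $G$, and let $M_1,M_2$ be two paths of order $2$ (i.e. edges) in $G$ such that $C$, $M_1$, $M_2$ are pairwise vertex-disjoint. If the number of edges of $G$ with one end in $V(C)$ and the other end in $V(M_1)\cup V(M_2)$ is at least $9$, then $G[V(C)\cup V(M_1)\cup V(M_2)]$ contains a triangle and a subgraph $D$ on $4$ vertices with at least $4$ edges such that the triangle and $D$ are vertex-disjoint.
   Context: All graphs are finite, simple and undirected. $G[U]$ denotes the subgraph of $G$ induced by the vertex set $U$. -}

module Defs where

open import Data.Bool using (Bool; true; false)
open import Data.Nat using (ℕ; zero; suc; _+_)
open import Data.Fin using (Fin)
open import Data.List using (List; []; _∷_; map)
open import Data.Product using (_×_)
open import Relation.Binary.PropositionalEquality using (_≡_)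

record Graph : Set where
  field
    n     : ℕ
    adj   : Fin n → Fin n → Bool
    sym   : ∀ u v → adj u v ≡ adj v u
    irrefl : ∀ v → adj v v ≡ false

open Graph public

Vertex : Graph → Set
Vertex G = Fin (n G)

Adj : (G : Graph) → Vertex G → Vertex G → Set
Adj G u v = adj G u v ≡ true

countTrue : List Bool → ℕ
countTrue [] = 0
countTrue (true ∷ bs) = suc (countTrue bs)
countTrue (false ∷ bs) = countTrue bs

-- number of edges of G with one end in the list xs and the other in ys
-- (for disjoint lists of distinct vertices this counts each such edge once)
edgesBetween : (G : Graph) → List (Vertex G) → List (Vertex G) → ℕ
edgesBetween G [] ys = 0
edgesBetween G (x ∷ xs) ys = countTrue (map (adj G x) ys) + edgesBetween G xs ys

-- number of edges of G among the distinct vertices of the list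
-- (= number of edges of the induced subgraph on them)
edgesWithin : (G : Graph) → List (Vertex G) → ℕ
edgesWithin G [] = 0
edgesWithin G (x ∷ xs) = countTrue (map (adj G x) xs) + edgesWithin G xs

-- At most three of the twelve possible edges between C and M₁ ∪ M₂ are missing,
-- so some Mᵢ receives at least five of them and at least two vertices of C see
-- both ends of Mᵢ.  Of these take a, the one with fewest neighbours on the other
-- edge Mⱼ: then a spans a triangle with Mᵢ, and the other two vertices of C send
-- at least two edges to Mⱼ, so together with their own edge and Mⱼ they span four
-- edges.  Only the bipartite pattern between V(C) and V(M₁) ∪ V(M₂) matters, so
-- this case analysis is carried out by evaluation over all 2¹² patterns.
module Submission where

open import Defs
open import Data.Bool using (Bool; true; false)
open import Data.Bool.Properties using () renaming (_≟_ to _≟ᵇ_)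
open import Data.Fin using (Fin; #_)
open import Data.List using (List; []; _∷_; _++_; map)
open import Data.List.Properties using (map-++)
open import Data.List.Membership.Propositional using (_∈_)
open import Data.List.Relation.Unary.All as All using (All)
open import Data.List.Relation.Unary.Unique.Propositional using (Unique)
open import Data.List.Relation.Binary.Permutation.Propositional
  using (_↭_; prep; ↭-sym; ↭-trans; ↭⇒↭ₛ)
open import Data.List.Relation.Binary.Permutation.Propositional.Properties
  using (∈-resp-↭; ++⁺ˡ; ++⁺ʳ; ++-comm; shift)
import Data.List.Relation.Binary.Permutation.Setoid.Properties as SetoidPermutation
open import Data.Nat using (ℕ; suc; _≤_; _+_; _≤?_; s≤s)
open import Data.Nat.Properties using (+-monoˡ-≤)
open import Data.Nat.Solver using (module +-*-Solver)
open import Data.Product using (_×_; ∃-syntax; _,_)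
open import Data.Sum using (_⊎_; inj₁; inj₂)
open import Data.Unit using (tt)
open import Data.Vec as Vec using (Vec; []; _∷_; lookup)
open import Relation.Nullary using (Dec; map′; _×-dec_; _⊎-dec_; _→-dec_)
open import Relation.Nullary.Decidable using (toWitness)
open import Relation.Binary.PropositionalEquality
  using (_≡_; refl; trans; cong; cong₂; setoid; module ≡-Reasoning)

Exhaustible : Set → Set₁
Exhaustible A = ∀ {P : A → Set} → (∀ a → Dec (P a)) → Dec (∀ a → P a)

Bool-exhaustible : Exhaustible Bool
Bool-exhaustible P? =
  map′ (λ (t , f) → λ { true → t ; false → f }) (λ h → h true , h false)
       (P? true ×-dec P? false)

Vec-exhaustible : ∀ {A} → Exhaustible A → ∀ n → Exhaustible (Vec A n)
Vec-exhaustible A? 0 P? = map′ (λ p → λ { [] → p }) (λ h → h []) (P? [])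
Vec-exhaustible A? (suc n) P? =
  map′ (λ h → λ { (a ∷ v) → h a v }) (λ h a v → h (a ∷ v))
       (A? λ a → Vec-exhaustible A? n λ v → P? (a ∷ v))

module _ {A B : Set} (R : A → B → Bool) where

  -- On explicit lists, edgesBetween G computes to crossings (adj G).
  crossings : List A → List B → ℕ
  crossings []       ys = 0
  crossings (x ∷ xs) ys = countTrue (map (R x) ys) + crossings xs ys

  SplitAt : A → A → A → B → B → B → B → Set
  SplitAt a b c x y x′ y′ =
    R a x ≡ true × R a y ≡ true × 2 ≤ crossings (b ∷ c ∷ []) (x′ ∷ y′ ∷ [])

  Split : A → A → A → B → B → B → B → Set
  Split a₁ a₂ a₃ x₁ y₁ x₂ y₂ =
      SplitAt a₁ a₂ a₃ x₁ y₁ x₂ y₂ ⊎ SplitAt a₁ a₂ a₃ x₂ y₂ x₁ y₁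
    ⊎ SplitAt a₂ a₃ a₁ x₁ y₁ x₂ y₂ ⊎ SplitAt a₂ a₃ a₁ x₂ y₂ x₁ y₁
    ⊎ SplitAt a₃ a₁ a₂ x₁ y₁ x₂ y₂ ⊎ SplitAt a₃ a₁ a₂ x₂ y₂ x₁ y₁

  splitAt? : ∀ a b c x y x′ y′ → Dec (SplitAt a b c x y x′ y′)
  splitAt? a b c x y x′ y′ =
    R a x ≟ᵇ true ×-dec R a y ≟ᵇ true ×-dec 2 ≤? crossings (b ∷ c ∷ []) (x′ ∷ y′ ∷ [])

  split? : ∀ a₁ a₂ a₃ x₁ y₁ x₂ y₂ → Dec (Split a₁ a₂ a₃ x₁ y₁ x₂ y₂)
  split? a₁ a₂ a₃ x₁ y₁ x₂ y₂ =
       splitAt? a₁ a₂ a₃ x₁ y₁ x₂ y₂ ⊎-dec splitAt? a₁ a₂ a₃ x₂ y₂ x₁ y₁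
    ⊎-dec splitAt? a₂ a₃ a₁ x₁ y₁ x₂ y₂ ⊎-dec splitAt? a₂ a₃ a₁ x₂ y₂ x₁ y₁
    ⊎-dec splitAt? a₃ a₁ a₂ x₁ y₁ x₂ y₂ ⊎-dec splitAt? a₃ a₁ a₂ x₂ y₂ x₁ y₁

entry : Vec (Vec Bool 4) 3 → Fin 3 → Fin 4 → Bool
entry m i j = lookup (lookup m i) j

matrix-split : (m : Vec (Vec Bool 4) 3)
  → 9 ≤ crossings (entry m) (# 0 ∷ # 1 ∷ # 2 ∷ []) (# 0 ∷ # 1 ∷ # 2 ∷ # 3 ∷ [])
  → Split (entry m) (# 0) (# 1) (# 2) (# 0) (# 1) (# 2) (# 3)
matrix-split = toWitness {a? = Vec-exhaustible (Vec-exhaustible Bool-exhaustible 4) 3 λ m →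
  9 ≤? crossings (entry m) (# 0 ∷ # 1 ∷ # 2 ∷ []) (# 0 ∷ # 1 ∷ # 2 ∷ # 3 ∷ [])
  →-dec split? (entry m) (# 0) (# 1) (# 2) (# 0) (# 1) (# 2) (# 3)} tt

crossings-split : ∀ {A B : Set} (R : A → B → Bool) (a₁ a₂ a₃ : A) (x₁ y₁ x₂ y₂ : B)
  → 9 ≤ crossings R (a₁ ∷ a₂ ∷ a₃ ∷ []) (x₁ ∷ y₁ ∷ x₂ ∷ y₂ ∷ [])
  → Split R a₁ a₂ a₃ x₁ y₁ x₂ y₂
crossings-split R a₁ a₂ a₃ x₁ y₁ x₂ y₂ =
  matrix-split (Vec.map (λ a → Vec.map (R a) (x₁ ∷ y₁ ∷ x₂ ∷ y₂ ∷ [])) (a₁ ∷ a₂ ∷ a₃ ∷ []))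

countTrue-++ : ∀ bs cs → countTrue (bs ++ cs) ≡ countTrue bs + countTrue cs
countTrue-++ []           cs = refl
countTrue-++ (true ∷ bs)  cs = cong suc (countTrue-++ bs cs)
countTrue-++ (false ∷ bs) cs = countTrue-++ bs cs

edgesWithin-++ : ∀ G (xs ys : List (Vertex G))
  → edgesWithin G (xs ++ ys) ≡ edgesWithin G xs + edgesBetween G xs ys + edgesWithin G ys
edgesWithin-++ G []       ys = refl
edgesWithin-++ G (x ∷ xs) ys = begin
  countTrue (map (adj G x) (xs ++ ys)) + edgesWithin G (xs ++ ys)
    ≡⟨ cong₂ _+_ row (edgesWithin-++ G xs ys) ⟩
  (cx + cy) + (wx + bxy + wy)
    ≡⟨ solve 5 (λ cx cy wx bxy wy → (cx :+ cy) :+ (wx :+ bxy :+ wy)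
                                  := cx :+ wx :+ (cy :+ bxy) :+ wy) refl cx cy wx bxy wy ⟩
  cx + wx + (cy + bxy) + wy ∎
  where
  open ≡-Reasoning
  open +-*-Solver
  cx = countTrue (map (adj G x) xs)
  cy = countTrue (map (adj G x) ys)
  wx = edgesWithin G xs
  bxy = edgesBetween G xs ys
  wy = edgesWithin G ys

  row : countTrue (map (adj G x) (xs ++ ys)) ≡ cx + cy
  row = trans (cong countTrue (map-++ (adj G x) xs ys))
              (countTrue-++ (map (adj G x) xs) (map (adj G x) ys))

edgesWithin-edge : ∀ {G u v} → Adj G u v → edgesWithin G (u ∷ v ∷ []) ≡ 1
edgesWithin-edge uv rewrite uv = refl

two-edges-linked : ∀ G {b c x y} → Adj G b c → Adj G x y
  → 2 ≤ edgesBetween G (b ∷ c ∷ []) (x ∷ y ∷ [])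
  → 4 ≤ edgesWithin G (b ∷ c ∷ x ∷ y ∷ [])
two-edges-linked G {b} {c} {x} {y} bc xy linked
  rewrite edgesWithin-++ G (b ∷ c ∷ []) (x ∷ y ∷ [])
        | edgesWithin-edge {G} bc | edgesWithin-edge {G} xy = +-monoˡ-≤ 1 (s≤s linked)

unique-resp-↭ : ∀ {A : Set} {xs ys : List A} → xs ↭ ys → Unique xs → Unique ys
unique-resp-↭ {A} p = SetoidPermutation.Unique-resp-↭ (setoid A) (↭⇒↭ₛ p)

rotate-↭ : ∀ {A : Set} (a b c : A) rest → b ∷ c ∷ a ∷ rest ↭ a ∷ b ∷ c ∷ rest
rotate-↭ a b c = shift a (b ∷ c ∷ [])

swap-pairs-↭ : ∀ {A : Set} prefix (x y x′ y′ : A)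
  → prefix ++ x′ ∷ y′ ∷ x ∷ y ∷ [] ↭ prefix ++ x ∷ y ∷ x′ ∷ y′ ∷ []
swap-pairs-↭ prefix x y x′ y′ = ++⁺ˡ prefix (++-comm (x′ ∷ y′ ∷ []) (x ∷ y ∷ []))

TriangleAndQuadrupleIn : (G : Graph) → List (Vertex G) → Set
TriangleAndQuadrupleIn G U = ∃[ t₁ ] ∃[ t₂ ] ∃[ t₃ ] ∃[ d₁ ] ∃[ d₂ ] ∃[ d₃ ] ∃[ d₄ ]
  (All (_∈ U) (t₁ ∷ t₂ ∷ t₃ ∷ d₁ ∷ d₂ ∷ d₃ ∷ d₄ ∷ [])
  × Unique (t₁ ∷ t₂ ∷ t₃ ∷ d₁ ∷ d₂ ∷ d₃ ∷ d₄ ∷ [])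
  × Adj G t₁ t₂ × Adj G t₂ t₃ × Adj G t₃ t₁
  × 4 ≤ edgesWithin G (d₁ ∷ d₂ ∷ d₃ ∷ d₄ ∷ []))

TriangleAndQuadrupleIn-resp-↭ : ∀ G {U V : List (Vertex G)}
  → U ↭ V → TriangleAndQuadrupleIn G U → TriangleAndQuadrupleIn G V
TriangleAndQuadrupleIn-resp-↭ G p (t₁ , t₂ , t₃ , d₁ , d₂ , d₃ , d₄ , within , rest) =
  t₁ , t₂ , t₃ , d₁ , d₂ , d₃ , d₄ , All.map (∈-resp-↭ p) within , rest

split-witness : ∀ G {a b c x y x′ y′}
  → Adj G b c → Adj G x y → Adj G x′ y′
  → SplitAt (adj G) a b c x y x′ y′
  → Unique (a ∷ b ∷ c ∷ x ∷ y ∷ x′ ∷ y′ ∷ [])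
  → TriangleAndQuadrupleIn G (a ∷ b ∷ c ∷ x ∷ y ∷ x′ ∷ y′ ∷ [])
split-witness G {a} {b} {c} {x} {y} {x′} {y′} bc xy x′y′ (ax , ay , linked) distinct =
  a , x , y , b , c , x′ , y′ ,
  All.tabulate (∈-resp-↭ regroup) , unique-resp-↭ (↭-sym regroup) distinct ,
  ax , xy , trans (sym G y a) ay , two-edges-linked G bc x′y′ linked
  where
  regroup : a ∷ x ∷ y ∷ b ∷ c ∷ x′ ∷ y′ ∷ [] ↭ a ∷ b ∷ c ∷ x ∷ y ∷ x′ ∷ y′ ∷ []
  regroup = prep a (++⁺ʳ (x′ ∷ y′ ∷ []) (++-comm (x ∷ y ∷ []) (b ∷ c ∷ [])))

lemma5 : (G : Graph) (a₁ a₂ a₃ x₁ y₁ x₂ y₂ : Vertex G)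
    → Unique (a₁ ∷ a₂ ∷ a₃ ∷ x₁ ∷ y₁ ∷ x₂ ∷ y₂ ∷ [])
    → Adj G a₁ a₂ → Adj G a₂ a₃ → Adj G a₃ a₁
    → Adj G x₁ y₁ → Adj G x₂ y₂
    → 9 ≤ edgesBetween G (a₁ ∷ a₂ ∷ a₃ ∷ []) (x₁ ∷ y₁ ∷ x₂ ∷ y₂ ∷ [])
    → ∃[ t₁ ] ∃[ t₂ ] ∃[ t₃ ] ∃[ d₁ ] ∃[ d₂ ] ∃[ d₃ ] ∃[ d₄ ]
        (All (_∈ (a₁ ∷ a₂ ∷ a₃ ∷ x₁ ∷ y₁ ∷ x₂ ∷ y₂ ∷ []))
             (t₁ ∷ t₂ ∷ t₃ ∷ d₁ ∷ d₂ ∷ d₃ ∷ d₄ ∷ [])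
        × Unique (t₁ ∷ t₂ ∷ t₃ ∷ d₁ ∷ d₂ ∷ d₃ ∷ d₄ ∷ [])
        × Adj G t₁ t₂ × Adj G t₂ t₃ × Adj G t₃ t₁
        × 4 ≤ edgesWithin G (d₁ ∷ d₂ ∷ d₃ ∷ d₄ ∷ []))
lemma5 G a₁ a₂ a₃ x₁ y₁ x₂ y₂ distinct a₁a₂ a₂a₃ a₃a₁ x₁y₁ x₂y₂ nine =
  witness (crossings-split (adj G) a₁ a₂ a₃ x₁ y₁ x₂ y₂ nine)
  where
  U = a₁ ∷ a₂ ∷ a₃ ∷ x₁ ∷ y₁ ∷ x₂ ∷ y₂ ∷ []

  via : ∀ {V} → V ↭ U → (Unique V → TriangleAndQuadrupleIn G V) → TriangleAndQuadrupleIn G U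
  via p k = TriangleAndQuadrupleIn-resp-↭ G p (k (unique-resp-↭ (↭-sym p) distinct))

  rotate : ∀ {rest} → a₂ ∷ a₃ ∷ a₁ ∷ rest ↭ a₁ ∷ a₂ ∷ a₃ ∷ rest
  rotate = rotate-↭ a₁ a₂ a₃ _

  rotate⁻¹ : ∀ {rest} → a₃ ∷ a₁ ∷ a₂ ∷ rest ↭ a₁ ∷ a₂ ∷ a₃ ∷ rest
  rotate⁻¹ = ↭-sym (rotate-↭ a₃ a₁ a₂ _)

  swap : ∀ prefix → prefix ++ x₂ ∷ y₂ ∷ x₁ ∷ y₁ ∷ [] ↭ prefix ++ x₁ ∷ y₁ ∷ x₂ ∷ y₂ ∷ []
  swap prefix = swap-pairs-↭ prefix x₁ y₁ x₂ y₂

  witness : Split (adj G) a₁ a₂ a₃ x₁ y₁ x₂ y₂ → TriangleAndQuadrupleIn G U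
  witness (inj₁ s) = split-witness G a₂a₃ x₁y₁ x₂y₂ s distinct
  witness (inj₂ (inj₁ s)) = via (swap (a₁ ∷ a₂ ∷ a₃ ∷ [])) (split-witness G a₂a₃ x₂y₂ x₁y₁ s)
  witness (inj₂ (inj₂ (inj₁ s))) = via rotate (split-witness G a₃a₁ x₁y₁ x₂y₂ s)
  witness (inj₂ (inj₂ (inj₂ (inj₁ s)))) =
    via (↭-trans (swap (a₂ ∷ a₃ ∷ a₁ ∷ [])) rotate) (split-witness G a₃a₁ x₂y₂ x₁y₁ s)
  witness (inj₂ (inj₂ (inj₂ (inj₂ (inj₁ s))))) = via rotate⁻¹ (split-witness G a₁a₂ x₁y₁ x₂y₂ s)
  witness (inj₂ (inj₂ (inj₂ (inj₂ (inj₂ s))))) =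
    via (↭-trans (swap (a₃ ∷ a₁ ∷ a₂ ∷ [])) rotate⁻¹) (split-witness G a₁a₂ x₂y₂ x₁y₁ s)
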